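{- Fix any definition for $FO\lambda^{\Delta\mathbb{N}}$. For any formula $C$ of type $o$, predicate $B: nt\to o$, term $I: nt$, finite multiset $\Gamma$ of formulas, and eigenvariable $i: nt$ not free in $B$, the inference rule $$\frac{\longrightarrow B\,z \qquad nat\, i\longrightarrow B\,(s\,i) \qquad B\,I,\Gamma\longrightarrow C}{nat\,I,\Gamma\longrightarrow C}$$ is derivable in $FO\lambda^{\Delta\mathbb{N}}$, i.e. there is a derivation of $nat\,I,\Gamma\longrightarrow C$ whose only unproved leaves are (instances of) the three premises.
   Context: $FO\lambda^{\Delta\mathbb{N}}$ is the following intuitionistic sequent calculus. Terms are simply typed $\lambda$-terms (up to $\alpha\beta\eta$-conversion) over a signature of typed constants; $o$ is the type of formulas, and quantifiers $\forall_\tau,\exists_\tau$ range only over types $\tau$ not containing $o$. Formulas are built from atomic formulas (a predicate constant applied to terms) with $\bot,\top,\land,\lor,\supset,\forall,\exists$. There is a type $nt$ with constants $z:nt$, $s:nt\to nt$ and a predicate $nat: nt\to o$. Sequents are $\Gamma\longrightarrow B$ with $\Gamma$ a finite multiset of formulas. Rules: $\bot,\Gamma\longrightarrow B$ and $\Gamma\longrightarrow\top$ are axioms; the usual intuitionistic left and right rules for $\land,\lor,\supset,\forall,\exists$ ($\forall$R and $\exists$L use an eigenvariable not free in the conclusion; $\forall$L and $\exists$R instantiate with an arbitrary term); initial sequents $A,\Gamma\longrightarrow A$ for atomic $A$; contraction on the left; cut (from $\Delta\longrightarrow B$ and $B,\Gamma\longrightarrow C$ infer $\Delta,\Gamma\longrightarrow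 C$). For $nat$: $\Gamma\longrightarrow nat\,z$ is an axiom; from $\Gamma\longrightarrow nat\,I$ infer $\Gamma\longrightarrow nat\,(s\,I)$; and induction: for any $B:nt\to o$ and eigenvariable $j$ not free in $B$, from $\longrightarrow B\,z$, $B\,j\longrightarrow B\,(s\,j)$ and $B\,I,\Gamma\longrightarrow C$ infer $nat\,I,\Gamma\longrightarrow C$. Derivations are relative to a fixed definition, a set of clauses $\forall\bar x[p\,\bar t\triangleq B]$ ($p$ a predicate constant, free variables of $B$ occurring in $\bar t$, free variables of $\bar t$ among $\bar x$; outer quantifiers are left implicit when written), subject to a level condition: each predicate has a natural-number level, extended to formulas by $lvl(p\,\bar t)=lvl(p)$, $lvl(\bot)=lvl(\top)=0$, $lvl(B\land C)=lvl(B\lor C)=\max(lvl B,lvl C)$, $lvl(B\supset C)=\max(lvl B+1,lvl C)$, $lvl(\forall x.B)=lvl(\exists x.B)=lvl B$, and every clause satisfies $lvl(B)\le lvl(p\,\bar t)$. Definition rules: from $\Gamma\longrightarrow B\theta$ infer $\Gamma\longrightarrow p\,\bar u$ when $p\,\bar u=(p\,\bar t)\theta$ for a clause $\forall\bar x[p\,\bar t\triangleq B]$; and infer $p\,\bar u,\Gamma\longrightarrow C$ from the set of premises $B\theta,\Gamma\theta\longrightarrow C\theta$, one for each clause $\forall \bar x[p\,\bar t\triangleq B]$ (variables $\bar x$ renamed apart from the conclusion) and each $\theta$ in a complete set of unifiers of $p\,\bar u$ and $p\,\bar t$. -}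

module Defs where

open import Data.Nat using (ℕ; zero; suc; _≤_; _⊔_)
open import Data.List using (List; []; _∷_; _++_; map)
open import Data.List.Relation.Unary.All using (All; []; _∷_)
import Data.List.Relation.Unary.All as All
open import Data.List.Relation.Binary.Permutation.Propositional using (_↭_)
open import Data.List.Relation.Binary.Pointwise using (Pointwise)
open import Data.Product using (Σ; _×_; _,_)
open import Relation.Binary.PropositionalEquality using (_≡_; subst)

-- The type o of formulas is NOT a term type here:
-- formulas are a separate syntactic category (Fm), so every term type
-- (and hence every quantifier domain) is automatically o-free.

data Ty (Base : Set) : Set where
  ι   : Base → Ty Base
  nt  : Ty Base
  _⇒_ : Ty Base → Ty Base → Ty Base

infixr 7 _⇒_

-- A signature of typed constants.  Term constants other than z, s and
-- predicate constants other than nat; predicates carry their argument types.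
record Signature : Set₁ where
  field
    Base  : Set
    Con   : Ty Base → Set
    Pred  : Set
    arity : Pred → List (Ty Base)

module FOL (S : Signature) where
  open Signature S

  Type : Set
  Type = Ty Base

  -- contexts of eigenvariables (de Bruijn, innermost first)
  Ctx : Set
  Ctx = List Type

  data _∋_ : Ctx → Type → Set where
    here  : ∀ {Δ τ} → (τ ∷ Δ) ∋ τ
    there : ∀ {Δ τ σ} → Δ ∋ τ → (σ ∷ Δ) ∋ τ

  -- simply typed λ-terms (intrinsically typed, de Bruijn: α-equivalence is
  -- syntactic identity)
  data Tm (Δ : Ctx) : Type → Set where
    var : ∀ {τ} → Δ ∋ τ → Tm Δ τ
    con : ∀ {τ} → Con τ → Tm Δ τ
    z   : Tm Δ nt
    s   : Tm Δ (nt ⇒ nt)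
    lam : ∀ {σ τ} → Tm (σ ∷ Δ) τ → Tm Δ (σ ⇒ τ)
    app : ∀ {σ τ} → Tm Δ (σ ⇒ τ) → Tm Δ σ → Tm Δ τ

  Args : Ctx → List Type → Set
  Args Δ τs = All (Tm Δ) τs

  Ren : Ctx → Ctx → Set
  Ren Δ Γ = ∀ {τ} → Δ ∋ τ → Γ ∋ τ

  ext : ∀ {Δ Γ σ} → Ren Δ Γ → Ren (σ ∷ Δ) (σ ∷ Γ)
  ext r here      = here
  ext r (there x) = there (r x)

  ren : ∀ {Δ Γ τ} → Ren Δ Γ → Tm Δ τ → Tm Γ τ
  ren r (var x)   = var (r x)
  ren r (con c)   = con c
  ren r z         = z
  ren r s         = s
  ren r (lam t)   = lam (ren (ext r) t)
  ren r (app t u) = app (ren r t) (ren r u)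

  Sub : Ctx → Ctx → Set
  Sub Δ Γ = ∀ {τ} → Δ ∋ τ → Tm Γ τ

  exts : ∀ {Δ Γ σ} → Sub Δ Γ → Sub (σ ∷ Δ) (σ ∷ Γ)
  exts ρ here      = var here
  exts ρ (there x) = ren there (ρ x)

  sub : ∀ {Δ Γ τ} → Sub Δ Γ → Tm Δ τ → Tm Γ τ
  sub ρ (var x)   = ρ x
  sub ρ (con c)   = con c
  sub ρ z         = z
  sub ρ s         = s
  sub ρ (lam t)   = lam (sub (exts ρ) t)
  sub ρ (app t u) = app (sub ρ t) (sub ρ u)

  _⨾_ : ∀ {Δ Γ Θ} → Sub Δ Γ → Sub Γ Θ → Sub Δ Θ
  (ρ ⨾ σ) x = sub σ (ρ x)

  subst0 : ∀ {Δ σ} → Tm Δ σ → Sub (σ ∷ Δ) Δ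
  subst0 u here      = u
  subst0 u (there x) = var x

  data _≈_ : ∀ {Δ τ} → Tm Δ τ → Tm Δ τ → Set where
    β      : ∀ {Δ σ τ} (t : Tm (σ ∷ Δ) τ) (u : Tm Δ σ) →
             app (lam t) u ≈ sub (subst0 u) t
    η      : ∀ {Δ σ τ} (t : Tm Δ (σ ⇒ τ)) →
             t ≈ lam (app (ren there t) (var here))
    ≈refl  : ∀ {Δ τ} {t : Tm Δ τ} → t ≈ t
    ≈sym   : ∀ {Δ τ} {t u : Tm Δ τ} → t ≈ u → u ≈ t
    ≈trans : ∀ {Δ τ} {t u v : Tm Δ τ} → t ≈ u → u ≈ v → t ≈ v
    lam≈   : ∀ {Δ σ τ} {t t' : Tm (σ ∷ Δ) τ} → t ≈ t' → lam t ≈ lam t'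
    app≈   : ∀ {Δ σ τ} {t t' : Tm Δ (σ ⇒ τ)} {u u' : Tm Δ σ} →
             t ≈ t' → u ≈ u' → app t u ≈ app t' u'

  data _≈A_ {Δ : Ctx} : ∀ {τs} → Args Δ τs → Args Δ τs → Set where
    []  : [] ≈A []
    _∷_ : ∀ {τ τs} {t t' : Tm Δ τ} {ts ts' : Args Δ τs} →
          t ≈ t' → ts ≈A ts' → (t ∷ ts) ≈A (t' ∷ ts')

  infixr 6 _∧_
  infixr 5 _∨_
  infixr 4 _⊃_

  data Fm (Δ : Ctx) : Set where
    atom : (p : Pred) → Args Δ (arity p) → Fm Δ
    nat  : Tm Δ nt → Fm Δ
    ⊥′ ⊤′ : Fm Δ
    _∧_ _∨_ _⊃_ : Fm Δ → Fm Δ → Fm Δ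
    all ex : (τ : Type) → Fm (τ ∷ Δ) → Fm Δ

  data IsAtomic {Δ : Ctx} : Fm Δ → Set where
    atom : ∀ p ts → IsAtomic (atom p ts)
    nat  : ∀ t → IsAtomic (nat t)

  subF : ∀ {Δ Γ} → Sub Δ Γ → Fm Δ → Fm Γ
  subF ρ (atom p ts) = atom p (All.map (sub ρ) ts)
  subF ρ (nat t)     = nat (sub ρ t)
  subF ρ ⊥′          = ⊥′
  subF ρ ⊤′          = ⊤′
  subF ρ (A ∧ B)     = subF ρ A ∧ subF ρ B
  subF ρ (A ∨ B)     = subF ρ A ∨ subF ρ B
  subF ρ (A ⊃ B)     = subF ρ A ⊃ subF ρ B
  subF ρ (all τ B)   = all τ (subF (exts ρ) B)
  subF ρ (ex τ B)    = ex τ (subF (exts ρ) B)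

  subA : ∀ {Δ Γ τs} → Sub Δ Γ → Args Δ τs → Args Γ τs
  subA ρ ts = All.map (sub ρ) ts

  wkF : ∀ {Δ σ} → Fm Δ → Fm (σ ∷ Δ)
  wkF = subF (λ x → var (there x))

  -- instantiation  B t  of an abstraction B : τ → o
  _[_] : ∀ {Δ τ} → Fm (τ ∷ Δ) → Tm Δ τ → Fm Δ
  B [ t ] = subF (subst0 t) B

  -- B (s j) for B : nt → o, in the context extended by the eigenvariable j
  -- (j = de Bruijn index 0, which is therefore not free in B itself)
  sucSub : ∀ {Δ} → Sub (nt ∷ Δ) (nt ∷ Δ)
  sucSub here      = app s (var here)
  sucSub (there x) = var (there x)

  data _≈F_ : ∀ {Δ} → Fm Δ → Fm Δ → Set where
    atom : ∀ {Δ} p {ts ts' : Args Δ (arity p)} → ts ≈A ts' → atom p ts ≈F atom p ts'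
    nat  : ∀ {Δ} {t t' : Tm Δ nt} → t ≈ t' → nat t ≈F nat t'
    ⊥′   : ∀ {Δ} → ⊥′ {Δ} ≈F ⊥′
    ⊤′   : ∀ {Δ} → ⊤′ {Δ} ≈F ⊤′
    _∧_  : ∀ {Δ} {A A' B B' : Fm Δ} → A ≈F A' → B ≈F B' → (A ∧ B) ≈F (A' ∧ B')
    _∨_  : ∀ {Δ} {A A' B B' : Fm Δ} → A ≈F A' → B ≈F B' → (A ∨ B) ≈F (A' ∨ B')
    _⊃_  : ∀ {Δ} {A A' B B' : Fm Δ} → A ≈F A' → B ≈F B' → (A ⊃ B) ≈F (A' ⊃ B')
    all  : ∀ {Δ} τ {B B' : Fm (τ ∷ Δ)} → B ≈F B' → all τ B ≈F all τ B'
    ex   : ∀ {Δ} τ {B B' : Fm (τ ∷ Δ)} → B ≈F B' → ex τ B ≈F ex τ B'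

  _≈Γ_ : ∀ {Δ} → List (Fm Δ) → List (Fm Δ) → Set
  Γ ≈Γ Γ' = Σ _ λ Γ'' → (Γ ↭ Γ'') × Pointwise _≈F_ Γ'' Γ'

  -- free occurrences (of a βη-class: free in every representative)

  data OccT {Δ σ} (x : Δ ∋ σ) : ∀ {τ} → Tm Δ τ → Set where
    var  : OccT x (var x)
    lam  : ∀ {ρ τ} {t : Tm (ρ ∷ Δ) τ} → OccT (there x) t → OccT x (lam t)
    appl : ∀ {ρ τ} {t : Tm Δ (ρ ⇒ τ)} {u} → OccT x t → OccT x (app t u)
    appr : ∀ {ρ τ} {t : Tm Δ (ρ ⇒ τ)} {u} → OccT x u → OccT x (app t u)

  data OccA {Δ σ} (x : Δ ∋ σ) : ∀ {τs} → Args Δ τs → Set where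
    hd : ∀ {τ τs} {t : Tm Δ τ} {ts : Args Δ τs} → OccT x t → OccA x (t ∷ ts)
    tl : ∀ {τ τs} {t : Tm Δ τ} {ts : Args Δ τs} → OccA x ts → OccA x (t ∷ ts)

  data OccF {Δ σ} (x : Δ ∋ σ) : Fm Δ → Set where
    atom : ∀ {p ts} → OccA x ts → OccF x (atom p ts)
    nat  : ∀ {t} → OccT x t → OccF x (nat t)
    l∧ : ∀ {A B} → OccF x A → OccF x (A ∧ B)
    r∧ : ∀ {A B} → OccF x B → OccF x (A ∧ B)
    l∨ : ∀ {A B} → OccF x A → OccF x (A ∨ B)
    r∨ : ∀ {A B} → OccF x B → OccF x (A ∨ B)
    l⊃ : ∀ {A B} → OccF x A → OccF x (A ⊃ B)
    r⊃ : ∀ {A B} → OccF x B → OccF x (A ⊃ B)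
    all : ∀ {τ B} → OccF (there x) B → OccF x (all τ B)
    ex  : ∀ {τ B} → OccF (there x) B → OccF x (ex τ B)

  FreeF : ∀ {Δ σ} → Δ ∋ σ → Fm Δ → Set
  FreeF x B = ∀ B' → B ≈F B' → OccF x B'

  FreeA : ∀ {Δ σ τs} → Δ ∋ σ → Args Δ τs → Set
  FreeA x ts = ∀ ts' → ts ≈A ts' → OccA x ts'

  lvlF : (Pred → ℕ) → ∀ {Δ} → Fm Δ → ℕ
  lvlF lv (atom p _) = lv p
  lvlF lv (nat _)    = 0
  lvlF lv ⊥′         = 0
  lvlF lv ⊤′         = 0
  lvlF lv (A ∧ B)    = lvlF lv A ⊔ lvlF lv B
  lvlF lv (A ∨ B)    = lvlF lv A ⊔ lvlF lv B
  lvlF lv (A ⊃ B)    = suc (lvlF lv A) ⊔ lvlF lv B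
  lvlF lv (all _ B)  = lvlF lv B
  lvlF lv (ex _ B)   = lvlF lv B

  -- definitions:  ∀ x̄ [ p t̄ ≜ B ]

  record Clause : Set where
    field
      pred : Pred
      vars : Ctx
      head : Args vars (arity pred)
      body : Fm vars

  record Definition : Set₁ where
    field
      CI     : Set
      clause : CI → Clause
      lvl    : Pred → ℕ
      strat  : ∀ c → lvlF lvl (Clause.body (clause c)) ≤ lvl (Clause.pred (clause c))
      fvcond : ∀ c {σ} (x : Clause.vars (clause c) ∋ σ) →
               FreeF x (Clause.body (clause c)) → FreeA x (Clause.head (clause c))

  module _ (D : Definition) where
    open Definition D

    -- a unifier of p ū (in context Δ) and the head p t̄ of clause c,
    -- the variables of the clause being renamed apart from Δ
    record Unifier {Δ} (c : CI) (p : Pred) (e : Clause.pred (clause c) ≡ p)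
                   (us : Args Δ (arity p)) : Set where
      field
        ctx : Ctx
        θΔ  : Sub Δ ctx
        θx  : Sub (Clause.vars (clause c)) ctx
        unifies : subA θΔ us ≈A
                  subA θx (subst (λ q → Args (Clause.vars (clause c)) (arity q)) e
                                 (Clause.head (clause c)))

    record CSU {Δ} (c : CI) (p : Pred) (e : Clause.pred (clause c) ≡ p)
               (us : Args Δ (arity p)) : Set₁ where
      field
        Idx  : Set
        uni  : Idx → Unifier c p e us
        complete : (v : Unifier c p e us) →
          Σ Idx λ k → Σ (Sub (Unifier.ctx (uni k)) (Unifier.ctx v)) λ τ →
            (∀ {σ} (x : Δ ∋ σ) → Unifier.θΔ v x ≈ (Unifier.θΔ (uni k) ⨾ τ) x) ×
            (∀ {σ} (x : Clause.vars (clause c) ∋ σ) →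
                     Unifier.θx v x ≈ (Unifier.θx (uni k) ⨾ τ) x)

    -- Sequents Δ ; Γ ⟶ C  (Δ the eigenvariables), derived in FOλ^{ΔN}
    -- from additional unproved leaves described by Hyp.
    module Derivations (Hyp : ∀ Δ → List (Fm Δ) → Fm Δ → Set) where

      data _⨟_⟶_ : (Δ : Ctx) → List (Fm Δ) → Fm Δ → Set₁ where
        leaf  : ∀ {Δ Γ C} → Hyp Δ Γ C → Δ ⨟ Γ ⟶ C
        -- sequents are taken up to multiset equality and αβη-conversion
        conv  : ∀ {Δ Γ Γ' C C'} → Γ ≈Γ Γ' → C ≈F C' → Δ ⨟ Γ ⟶ C → Δ ⨟ Γ' ⟶ C'
        ⊥L    : ∀ {Δ Γ C} → Δ ⨟ (⊥′ ∷ Γ) ⟶ C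
        ⊤R    : ∀ {Δ Γ} → Δ ⨟ Γ ⟶ ⊤′
        init  : ∀ {Δ Γ A} → IsAtomic A → Δ ⨟ (A ∷ Γ) ⟶ A
        ∧L₁   : ∀ {Δ Γ A B C} → Δ ⨟ (A ∷ Γ) ⟶ C → Δ ⨟ ((A ∧ B) ∷ Γ) ⟶ C
        ∧L₂   : ∀ {Δ Γ A B C} → Δ ⨟ (B ∷ Γ) ⟶ C → Δ ⨟ ((A ∧ B) ∷ Γ) ⟶ C
        ∧R    : ∀ {Δ Γ A B} → Δ ⨟ Γ ⟶ A → Δ ⨟ Γ ⟶ B → Δ ⨟ Γ ⟶ (A ∧ B)
        ∨L    : ∀ {Δ Γ A B C} → Δ ⨟ (A ∷ Γ) ⟶ C → Δ ⨟ (B ∷ Γ) ⟶ C →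
                Δ ⨟ ((A ∨ B) ∷ Γ) ⟶ C
        ∨R₁   : ∀ {Δ Γ A B} → Δ ⨟ Γ ⟶ A → Δ ⨟ Γ ⟶ (A ∨ B)
        ∨R₂   : ∀ {Δ Γ A B} → Δ ⨟ Γ ⟶ B → Δ ⨟ Γ ⟶ (A ∨ B)
        ⊃L    : ∀ {Δ Γ A B C} → Δ ⨟ Γ ⟶ A → Δ ⨟ (B ∷ Γ) ⟶ C →
                Δ ⨟ ((A ⊃ B) ∷ Γ) ⟶ C
        ⊃R    : ∀ {Δ Γ A B} → Δ ⨟ (A ∷ Γ) ⟶ B → Δ ⨟ Γ ⟶ (A ⊃ B)
        ∀L    : ∀ {Δ Γ τ B C} (t : Tm Δ τ) → Δ ⨟ (B [ t ] ∷ Γ) ⟶ C →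
                Δ ⨟ (all τ B ∷ Γ) ⟶ C
        ∀R    : ∀ {Δ Γ τ B} → (τ ∷ Δ) ⨟ map wkF Γ ⟶ B → Δ ⨟ Γ ⟶ all τ B
        ∃L    : ∀ {Δ Γ τ B C} → (τ ∷ Δ) ⨟ (B ∷ map wkF Γ) ⟶ wkF C →
                Δ ⨟ (ex τ B ∷ Γ) ⟶ C
        ∃R    : ∀ {Δ Γ τ B} (t : Tm Δ τ) → Δ ⨟ Γ ⟶ (B [ t ]) → Δ ⨟ Γ ⟶ ex τ B
        contr : ∀ {Δ Γ A C} → Δ ⨟ (A ∷ A ∷ Γ) ⟶ C → Δ ⨟ (A ∷ Γ) ⟶ C
        cut   : ∀ {Δ Γ₁ Γ₂ A C} → Δ ⨟ Γ₁ ⟶ A → Δ ⨟ (A ∷ Γ₂) ⟶ C →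
                Δ ⨟ (Γ₁ ++ Γ₂) ⟶ C
        natZ  : ∀ {Δ Γ} → Δ ⨟ Γ ⟶ nat z
        natS  : ∀ {Δ Γ I} → Δ ⨟ Γ ⟶ nat I → Δ ⨟ Γ ⟶ nat (app s I)
        -- induction; B : nt → o is represented by B : Fm (nt ∷ Δ), and the
        -- eigenvariable j is the fresh index 0 of the middle premise
        ind   : ∀ {Δ Γ C} (B : Fm (nt ∷ Δ)) (I : Tm Δ nt) →
                Δ ⨟ [] ⟶ (B [ z ]) →
                (nt ∷ Δ) ⨟ (B ∷ []) ⟶ subF sucSub B →
                Δ ⨟ (B [ I ] ∷ Γ) ⟶ C →
                Δ ⨟ (nat I ∷ Γ) ⟶ C
        defR  : ∀ {Δ Γ} (c : CI) (θ : Sub (Clause.vars (clause c)) Δ) →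
                Δ ⨟ Γ ⟶ subF θ (Clause.body (clause c)) →
                Δ ⨟ Γ ⟶ atom (Clause.pred (clause c)) (subA θ (Clause.head (clause c)))
        defL  : ∀ {Δ Γ C} (p : Pred) (us : Args Δ (arity p))
                (U : (c : CI) (e : Clause.pred (clause c) ≡ p) → CSU c p e us) →
                ((c : CI) (e : Clause.pred (clause c) ≡ p) (k : CSU.Idx (U c e)) →
                  let θ = CSU.uni (U c e) k in
                  Unifier.ctx θ ⨟
                    (subF (Unifier.θx θ) (Clause.body (clause c)) ∷ map (subF (Unifier.θΔ θ)) Γ)
                    ⟶ subF (Unifier.θΔ θ) C) →
                Δ ⨟ (atom p us ∷ Γ) ⟶ C

  data Inst {Δ₀ : Ctx} (Γ₀ : List (Fm Δ₀)) (C₀ : Fm Δ₀) :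
            (Δ : Ctx) → List (Fm Δ) → Fm Δ → Set where
    inst : ∀ {Δ} (ρ : Sub Δ₀ Δ) → Inst Γ₀ C₀ Δ (map (subF ρ) Γ₀) (subF ρ C₀)

  data Prop21Leaves {Δ : Ctx} (B : Fm (nt ∷ Δ)) (I : Tm Δ nt)
                    (Γ : List (Fm Δ)) (C : Fm Δ) :
                    (Δ' : Ctx) → List (Fm Δ') → Fm Δ' → Set where
    prem₁ : ∀ {Δ' Γ' C'} → Inst [] (B [ z ]) Δ' Γ' C' →
            Prop21Leaves B I Γ C Δ' Γ' C'
    prem₂ : ∀ {Δ' Γ' C'} → Inst (nat (var here) ∷ []) (subF sucSub B) Δ' Γ' C' →
            Prop21Leaves B I Γ C Δ' Γ' C'
    prem₃ : ∀ {Δ' Γ' C'} → Inst (B [ I ] ∷ Γ) C Δ' Γ' C' →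
            Prop21Leaves B I Γ C Δ' Γ' C'

  Derivable : Definition → (Hyp : ∀ Δ → List (Fm Δ) → Fm Δ → Set) →
              (Δ : Ctx) → List (Fm Δ) → Fm Δ → Set₁
  Derivable D Hyp = Derivations._⨟_⟶_ D Hyp

-- Induct not on B but on the strengthened predicate  λ j. nat j ∧ B j.  Its base
-- case is  nat z ∧ B z;  in its step case the hypothesis  nat j ∧ B j  yields both
-- nat (s j) (by natS) and, through  nat j ⟶ B (s j),  also B (s j); finally the
-- conclusion  nat I ∧ B I  is weakened to  B I  for the third premise.
module Submission where

open import Defs
open import Data.List using (List; []; _∷_; map)
import Data.List.Properties as List
import Data.List.Relation.Unary.All.Properties as All
open import Relation.Binary.PropositionalEquality using (_≡_; refl; cong; cong₂; trans; subst₂)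

module _ (S : Signature) where
  open FOL S

  PointwiseVar : ∀ {Δ} → Sub Δ Δ → Set
  PointwiseVar {Δ} ρ = ∀ {τ} (x : Δ ∋ τ) → ρ x ≡ var x

  exts-pointwiseVar : ∀ {Δ σ} {ρ : Sub Δ Δ} → PointwiseVar ρ →
                      PointwiseVar (exts {σ = σ} ρ)
  exts-pointwiseVar ρ≡var here      = refl
  exts-pointwiseVar ρ≡var (there x) = cong (ren there) (ρ≡var x)

  sub-pointwiseVar : ∀ {Δ τ} {ρ : Sub Δ Δ} → PointwiseVar ρ →
                     (t : Tm Δ τ) → sub ρ t ≡ t
  sub-pointwiseVar ρ≡var (var x)   = ρ≡var x
  sub-pointwiseVar ρ≡var (con c)   = refl
  sub-pointwiseVar ρ≡var z         = refl
  sub-pointwiseVar ρ≡var s         = refl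
  sub-pointwiseVar ρ≡var (lam t)   =
    cong lam (sub-pointwiseVar (exts-pointwiseVar ρ≡var) t)
  sub-pointwiseVar ρ≡var (app t u) =
    cong₂ app (sub-pointwiseVar ρ≡var t) (sub-pointwiseVar ρ≡var u)

  subF-pointwiseVar : ∀ {Δ} {ρ : Sub Δ Δ} → PointwiseVar ρ →
                      (F : Fm Δ) → subF ρ F ≡ F
  subF-pointwiseVar ρ≡var (atom p ts) =
    cong (atom p) (trans (All.map-cong ts (sub-pointwiseVar ρ≡var)) (All.map-id ts))
  subF-pointwiseVar ρ≡var (nat t)   = cong nat (sub-pointwiseVar ρ≡var t)
  subF-pointwiseVar ρ≡var ⊥′        = refl
  subF-pointwiseVar ρ≡var ⊤′        = refl
  subF-pointwiseVar ρ≡var (A ∧ B)   =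
    cong₂ _∧_ (subF-pointwiseVar ρ≡var A) (subF-pointwiseVar ρ≡var B)
  subF-pointwiseVar ρ≡var (A ∨ B)   =
    cong₂ _∨_ (subF-pointwiseVar ρ≡var A) (subF-pointwiseVar ρ≡var B)
  subF-pointwiseVar ρ≡var (A ⊃ B)   =
    cong₂ _⊃_ (subF-pointwiseVar ρ≡var A) (subF-pointwiseVar ρ≡var B)
  subF-pointwiseVar ρ≡var (all τ B) =
    cong (all τ) (subF-pointwiseVar (exts-pointwiseVar ρ≡var) B)
  subF-pointwiseVar ρ≡var (ex τ B)  =
    cong (ex τ) (subF-pointwiseVar (exts-pointwiseVar ρ≡var) B)

  subF-var : ∀ {Δ} (F : Fm Δ) → subF var F ≡ F
  subF-var = subF-pointwiseVar (λ _ → refl)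

  map-subF-var : ∀ {Δ} (Γ : List (Fm Δ)) → map (subF var) Γ ≡ Γ
  map-subF-var Γ = trans (List.map-cong subF-var Γ) (List.map-id Γ)

  Inst-refl : ∀ {Δ} {Γ : List (Fm Δ)} {C : Fm Δ} → Inst Γ C Δ Γ C
  Inst-refl {Δ} {Γ} {C} = subst₂ (Inst Γ C Δ) (map-subF-var Γ) (subF-var C) (inst var)

proposition2p1 : (S : Signature) → let open FOL S in
    (D : Definition) {Δ : Ctx} (C : Fm Δ) (B : Fm (nt ∷ Δ)) (I : Tm Δ nt)
    (Γ : List (Fm Δ)) →
    Derivable D (Prop21Leaves B I Γ C) Δ (nat I ∷ Γ) C
proposition2p1 S D {Δ} C B I Γ = ind (nat (var here) ∧ B) I base step use
  where
  open FOL S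
  open Derivations D (Prop21Leaves B I Γ C)

  base : Δ ⨟ [] ⟶ (nat z ∧ B [ z ])
  base = ∧R natZ (leaf (prem₁ (Inst-refl S)))

  step : (nt ∷ Δ) ⨟ (nat (var here) ∧ B) ∷ [] ⟶ (nat (app s (var here)) ∧ subF sucSub B)
  step = ∧R (∧L₁ (natS (init (nat (var here))))) (∧L₁ (leaf (prem₂ (Inst-refl S))))

  use : Δ ⨟ (nat I ∧ B [ I ]) ∷ Γ ⟶ C
  use = ∧L₂ (leaf (prem₃ (Inst-refl S)))
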